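{- Let $n\geq m\geq 1$ be integers and let $G_{n,m}$ be the complement of the $n\times m$ rook's graph. Then \[\chi_{\mathrm{cen}}(G_{n,m})=\chi_{\mathrm{lin}}(G_{n,m})=\begin{cases} nm-n+1 & \text{if } m\geq 2 \text{ and } n\geq 3,\\ m & \text{otherwise.}\end{cases}\]
   Context: The $n\times m$ rook's graph has $nm$ vertices arranged into $m$ columns of $n$ vertices and $n$ rows of $m$ vertices, two vertices being adjacent iff they lie in the same row or the same column; its complement therefore has two distinct vertices adjacent iff they lie in different rows and different columns. A centered coloring of a graph $G$ assigns integers (colors) to vertices so that every connected subgraph contains a vertex whose color is unique in that subgraph; $\chi_{\mathrm{cen}}(G)$ is the minimum number of colors of such a coloring. A linear coloring requires the same only for every path of $G$ (as a subgraph); $\chi_{\mathrm{lin}}(G)$ is the minimum number of colors of a linear coloring. -}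

module Defs where

open import Data.Nat using (ℕ; _≤_; _+_; _*_; _∸_)
open import Data.Fin using (Fin)
open import Data.Bool using (Bool; true)
open import Data.Product using (Σ; _×_; ∃; ∃-syntax)
open import Data.List using (List; [])
open import Data.List.Membership.Propositional using (_∈_)
open import Data.List.Relation.Unary.Linked using (Linked)
open import Data.List.Relation.Unary.Unique.Propositional using (Unique)
open import Relation.Binary.PropositionalEquality using (_≡_; _≢_)
open import Relation.Nullary using (¬_)

record Graph : Set₁ where
  field
    V   : Set
    Adj : V → V → Set

open Graph public

data WalkIn (G : Graph) (S : V G → Set) : V G → V G → Set where
  stay : ∀ {u} → S u → WalkIn G S u u
  step : ∀ {u w v} → S u → Adj G u w → WalkIn G S w v → WalkIn G S u v

-- A vertex set S spans a connected subgraph of G: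
-- S is nonempty and any two of its vertices are joined by a walk inside S.
-- (A connected subgraph of G with vertex set S exists iff this holds.)
ConnectedVertexSet : (G : Graph) → (V G → Bool) → Set
ConnectedVertexSet G S =
  (∃[ v ] S v ≡ true) ×
  (∀ u v → S u ≡ true → S v ≡ true → WalkIn G (λ x → S x ≡ true) u v)

HasUniqueColourSet : {G : Graph} {k : ℕ} → (V G → Fin k) → (V G → Bool) → Set
HasUniqueColourSet {G} c S =
  ∃[ v ] (S v ≡ true × (∀ w → S w ≡ true → c w ≡ c v → w ≡ v))

IsCentered : (G : Graph) {k : ℕ} → (V G → Fin k) → Set
IsCentered G c = ∀ (S : V G → Bool) → ConnectedVertexSet G S → HasUniqueColourSet {G} c S

IsPath : (G : Graph) → List (V G) → Set
IsPath G ps = (ps ≢ []) × Unique ps × Linked (Adj G) ps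

HasUniqueColourList : {G : Graph} {k : ℕ} → (V G → Fin k) → List (V G) → Set
HasUniqueColourList {G} c ps =
  ∃[ v ] (v ∈ ps × (∀ w → w ∈ ps → c w ≡ c v → w ≡ v))

IsLinear : (G : Graph) {k : ℕ} → (V G → Fin k) → Set
IsLinear G c = ∀ (ps : List (V G)) → IsPath G ps → HasUniqueColourList {G} c ps

IsMinColours : (G : Graph) → (P : {k : ℕ} → (V G → Fin k) → Set) → ℕ → Set
IsMinColours G P k =
  (Σ (V G → Fin k) (λ c → P c)) ×
  (∀ k' → (c : V G → Fin k') → P c → k ≤ k')

ChiCen : Graph → ℕ → Set
ChiCen G k = IsMinColours G (IsCentered G) k

ChiLin : Graph → ℕ → Set
ChiLin G k = IsMinColours G (IsLinear G) k

-- Complement of the n × m rook's graph: vertices (row i, column j),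
-- i : Fin n (n rows), j : Fin m (m columns); adjacent iff different row and column.
RookComplement : ℕ → ℕ → Graph
RookComplement n m = record
  { V   = Fin n × Fin m
  ; Adj = λ x y → (Data.Product.proj₁ x ≢ Data.Product.proj₁ y) × (Data.Product.proj₂ x ≢ Data.Product.proj₂ y)
  }

module Submission where

-- Two cells of the same colour ("twins") in a linear colouring are non-adjacent, so they share a
-- row or a column.  A handful of small configurations of twins are impossible, since each of them
-- lies on a path on which no colour occurs exactly once; they are refuted on concrete grids with at
-- most four rows and columns and moved into place by relabelling rows and columns, and by
-- transposition.  A case analysis on where the twins lie then shows that all of them meet a set R
-- which is a column minus one cell, a row minus one cell, or (when m < n) a whole row.  The colouring
-- is injective off R, and at least n(m - 1) + 1 cells lie off R.  Conversely, giving the first column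
-- one colour and every other cell its own colour is centered: a connected set either contains a cell
-- outside the first column, whose colour is then unique, or lies inside that independent column and
-- is a single vertex.  For m = 1 the graph has no edges; for n = m = 2 it is a perfect matching whose
-- edges join different columns, so colouring by column is centered.

open import Defs
open import Data.Bool using (Bool; true) renaming (_≟_ to _≟ᵇ_)
open import Data.Nat using (ℕ; zero; suc; _≤_; _<_; _+_; _*_; _∸_; z≤n; s≤s; s≤s⁻¹; _<?_; _≤?_)
open import Data.Nat.Properties
  using (≤-trans; ≮⇒≥; +-assoc; +-comm; +-monoˡ-≤; *-suc; m+n∸m≡n; module ≤-Reasoning)
open import Data.Fin using (Fin; zero; suc; #_; _≟_; punchIn; combine; remQuot)
open import Data.Fin.Properties
  using (any?; injective⇒≤; punchIn-injective; punchInᵢ≢i; combine-injective; suc-injective; toℕ<n; *↔×)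
open import Data.Product using (_×_; _,_; proj₁; proj₂; ∃-syntax; swap)
open import Data.Product.Properties using (≡-dec; ,-injectiveˡ; ,-injectiveʳ)
open import Data.Sum as Sum using (_⊎_; inj₁; inj₂; [_,_])
open import Data.Empty using (⊥; ⊥-elim)
open import Data.List using (List; []; _∷_; map; length; lookup)
open import Data.List.Membership.Propositional using (_∈_)
open import Data.List.Membership.Propositional.Properties using (∈-map⁺; ∈-map⁻; ∈-lookup)
import Data.List.Membership.DecPropositional as MembershipDec
open import Data.List.Relation.Unary.Any using (here; there)
open import Data.List.Relation.Unary.All as All using (All; []; _∷_)
open import Data.List.Relation.Unary.AllPairs using ([]; _∷_)
open import Data.List.Relation.Unary.Linked as Linked using (Linked; []; [-]; _∷_; linked?)
import Data.List.Relation.Unary.Linked.Properties as Linked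
open import Data.List.Relation.Unary.Unique.Propositional using (Unique)
import Data.List.Relation.Unary.Unique.Propositional.Properties as Unique
import Data.List.Relation.Unary.Unique.DecPropositional as UniqueDec
import Data.Vec.Functional as Vector
open import Function using (_∘_; id)
open import Function.Bundles using (Injection)
open import Function.Definitions using (Injective)
open import Function.Properties.Inverse using (↔⇒↣)
open import Relation.Binary.Definitions using (DecidableEquality)
open import Relation.Binary.PropositionalEquality
  using (_≡_; _≢_; refl; sym; trans; cong; cong₂; subst; module ≡-Reasoning)
open import Relation.Nullary using (¬_; Dec; yes; no; ¬?; does)
open import Relation.Nullary.Decidable
  using (True; False; toWitness; toWitnessFalse; _×-dec_; map′; dec-true; decidable-stable)
open import Relation.Nullary.Negation using (¬¬-map)

by-cases : (P : Set) → (P → ⊥) → (¬ P → ⊥) → ⊥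
by-cases P if-so if-not = if-not if-so

third-element : ∀ {N} → 3 ≤ N → (a b : Fin N) → ∃[ z ] z ≢ a × z ≢ b
third-element (s≤s (s≤s (s≤s _))) (suc _) (suc _) = zero , (λ ()) , (λ ())
third-element (s≤s (s≤s (s≤s _))) zero zero = suc zero , (λ ()) , (λ ())
third-element (s≤s (s≤s (s≤s _))) zero (suc zero) = suc (suc zero) , (λ ()) , (λ ())
third-element (s≤s (s≤s (s≤s _))) zero (suc (suc _)) = suc zero , (λ ()) , (λ ())
third-element (s≤s (s≤s (s≤s _))) (suc zero) zero = suc (suc zero) , (λ ()) , (λ ())
third-element (s≤s (s≤s (s≤s _))) (suc (suc _)) zero = suc zero , (λ ()) , (λ ())

distinct₂ : ∀ {A : Set} {x y : A} → x ≢ y → Unique (x ∷ y ∷ [])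
distinct₂ x≢y = (x≢y ∷ []) ∷ [] ∷ []

distinct₃ : ∀ {A : Set} {x y z : A} → x ≢ y → x ≢ z → y ≢ z → Unique (x ∷ y ∷ z ∷ [])
distinct₃ x≢y x≢z y≢z = (x≢y ∷ x≢z ∷ []) ∷ distinct₂ y≢z

distinct₄ : ∀ {A : Set} {x y z w : A} → x ≢ y → x ≢ z → x ≢ w → y ≢ z → y ≢ w → z ≢ w →
            Unique (x ∷ y ∷ z ∷ w ∷ [])
distinct₄ x≢y x≢z x≢w y≢z y≢w z≢w = (x≢y ∷ x≢z ∷ x≢w ∷ []) ∷ distinct₃ y≢z y≢w z≢w

lookup-injective : ∀ {A : Set} {xs : List A} → Unique xs → Injective _≡_ _≡_ (lookup xs)
lookup-injective {xs = _ ∷ _} _ {zero} {zero} _ = refl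
lookup-injective {xs = _ ∷ _} (x∉xs ∷ _) {zero} {suc j} x≡xsⱼ =
  ⊥-elim (All.lookup x∉xs (∈-lookup j) x≡xsⱼ)
lookup-injective {xs = _ ∷ _} (x∉xs ∷ _) {suc i} {zero} xsᵢ≡x =
  ⊥-elim (All.lookup x∉xs (∈-lookup i) (sym xsᵢ≡x))
lookup-injective {xs = _ ∷ _} (_ ∷ unique) {suc i} {suc j} e = cong suc (lookup-injective unique e)

cons-injective : ∀ {A : Set} {M} {x : A} {f : Fin M → A} →
                 Injective _≡_ _≡_ f → (∀ t → f t ≢ x) → Injective _≡_ _≡_ (x Vector.∷ f)
cons-injective f-injective x∉f {zero} {zero} _ = refl
cons-injective f-injective x∉f {zero} {suc t} x≡ft = ⊥-elim (x∉f t (sym x≡ft))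
cons-injective f-injective x∉f {suc s} {zero} fs≡x = ⊥-elim (x∉f s fs≡x)
cons-injective f-injective x∉f {suc s} {suc t} fs≡ft = cong suc (f-injective fs≡ft)

remQuot-injective : ∀ {a} b → Injective _≡_ _≡_ (remQuot {a} b)
remQuot-injective b = Injection.injective (↔⇒↣ *↔×)

-- Walks, paths and colourings of graphs

module _ {G : Graph} {P : V G → Set} where

  walk-start : ∀ {u v} → WalkIn G P u v → P u
  walk-start (stay pu) = pu
  walk-start (step pu _ _) = pu

  _◅◅_ : ∀ {u v w} → WalkIn G P u v → WalkIn G P v w → WalkIn G P u w
  stay _ ◅◅ q = q
  step pu uw p ◅◅ q = step pu uw (p ◅◅ q)

  reverse : (∀ {u v} → Adj G u v → Adj G v u) → ∀ {u v} → WalkIn G P u v → WalkIn G P v u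
  reverse adj-sym (stay pu) = stay pu
  reverse adj-sym (step pu uw rest) = reverse adj-sym rest ◅◅ step (walk-start rest) (adj-sym uw) (stay pu)

  walk-invariant : ∀ {A : Set} (f : V G → A) → (∀ {u v} → P u → P v → Adj G u v → f u ≡ f v) →
                   ∀ {u v} → WalkIn G P u v → f u ≡ f v
  walk-invariant f invariant (stay _) = refl
  walk-invariant f invariant (step pu uw rest) =
    trans (invariant pu (walk-start rest) uw) (walk-invariant f invariant rest)

  linked-walk : ∀ {x xs y} → Linked (Adj G) (x ∷ xs) → All P (x ∷ xs) → y ∈ x ∷ xs → WalkIn G P x y
  linked-walk _ (px ∷ _) (here refl) = stay px
  linked-walk [-] _ (there ())
  linked-walk (xy ∷ linked) (px ∷ pxs) (there y∈xs) = step px xy (linked-walk linked pxs y∈xs)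

module _ {G : Graph} (adj-sym : ∀ {u v} → Adj G u v → Adj G v u) (_≟ᵛ_ : DecidableEquality (V G)) where
  open MembershipDec _≟ᵛ_ using (_∈?_)

  private
    member : ∀ {z ps} → does (z ∈? ps) ≡ true → z ∈ ps
    member {z} {ps} with z ∈? ps
    ... | yes z∈ps = λ _ → z∈ps
    ... | no _ = λ ()

  path-connected : ∀ {ps} → IsPath G ps → ConnectedVertexSet G (λ z → does (z ∈? ps))
  path-connected {[]} (≢[] , _) = ⊥-elim (≢[] refl)
  path-connected {ps@(x ∷ _)} (_ , _ , linked) =
    (x , dec-true (x ∈? ps) (here refl)) ,
    λ u w u∈ps w∈ps → reverse adj-sym (linked-walk linked members (member u∈ps)) ◅◅
                      linked-walk linked members (member w∈ps)
    where
    members : All (λ z → does (z ∈? ps) ≡ true) ps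
    members = All.tabulate (dec-true (_ ∈? ps))

  centered⇒linear : ∀ {k} {c : V G → Fin k} → IsCentered G c → IsLinear G c
  centered⇒linear centered ps path with centered _ (path-connected path)
  ... | v , v∈ps , unique = v , member v∈ps , λ w w∈ps → unique w (dec-true (w ∈? ps) w∈ps)

independent⇒unique-colour : ∀ {G k} (c : V G → Fin k) {S} → ConnectedVertexSet G S →
                            (∀ {u v} → S u ≡ true → S v ≡ true → ¬ Adj G u v) → HasUniqueColourSet {G} c S
independent⇒unique-colour c ((v , v∈S) , connected) independent = v , v∈S , λ w w∈S _ →
  sym (walk-invariant id (λ Su Sv uv → ⊥-elim (independent Su Sv uv)) (connected v w v∈S w∈S))

Twin : {A : Set} {k : ℕ} → (A → Fin k) → List A → A → Set
Twin c ps v = ∃[ w ] w ∈ ps × w ≢ v × c w ≡ c v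

module _ {G : Graph} {k : ℕ} {c : V G → Fin k} (lin : IsLinear G c) where

  linear⇒no-twinned-path : ∀ {ps} → IsPath G ps → ¬ All (Twin c ps) ps
  linear⇒no-twinned-path path twins with lin _ path
  ... | v , v∈ps , unique with All.lookup twins v∈ps
  ...   | w , w∈ps , w≢v , cw≡cv = w≢v (unique w w∈ps cw≡cv)

  linear⇒proper : ∀ {u v} → u ≢ v → Adj G u v → c u ≢ c v
  linear⇒proper {u} {v} u≢v uv cu≡cv = linear⇒no-twinned-path
    ((λ ()) , distinct₂ u≢v , (uv ∷ [-]))
    ((v , there (here refl) , u≢v ∘ sym , sym cu≡cv) ∷ (u , here refl , u≢v , cu≡cv) ∷ [])

  adjacent⇒2≤colours : ∀ {u v} → u ≢ v → Adj G u v → 2 ≤ k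
  adjacent⇒2≤colours {u} {v} u≢v uv = injective⇒≤ {f = colour-of} injective
    where
    colour-of : Fin 2 → Fin k
    colour-of = c u Vector.∷ c v Vector.∷ Vector.[]
    injective : Injective _≡_ _≡_ colour-of
    injective {zero} {zero} _ = refl
    injective {zero} {suc zero} cu≡cv = ⊥-elim (linear⇒proper u≢v uv cu≡cv)
    injective {suc zero} {zero} cv≡cu = ⊥-elim (linear⇒proper u≢v uv (sym cv≡cu))
    injective {suc zero} {suc zero} _ = refl

Chromatic : Graph → ℕ → Set
Chromatic G k = ChiCen G k × ChiLin G k

chromatic : ∀ {G k} → (∀ {k′} {c : V G → Fin k′} → IsCentered G c → IsLinear G c) →
            (c : V G → Fin k) → IsCentered G c →
            (∀ k′ (c′ : V G → Fin k′) → IsLinear G c′ → k ≤ k′) → Chromatic G k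
chromatic centered⇒linear c centered lower =
  ((c , centered) , λ k′ c′ → lower k′ c′ ∘ centered⇒linear) , ((c , centered⇒linear centered) , lower)

record _↪_ (G H : Graph) : Set where
  field
    embed     : V G → V H
    injective : Injective _≡_ _≡_ embed
    adjacent  : ∀ {u v} → Adj G u v → Adj H (embed u) (embed v)

module _ {G H : Graph} (e : G ↪ H) where
  open _↪_ e

  embed-path : ∀ {ps} → IsPath G ps → IsPath H (map embed ps)
  embed-path {[]} (≢[] , _) = ⊥-elim (≢[] refl)
  embed-path {_ ∷ _} (_ , unique , linked) =
    (λ ()) , Unique.map⁺ injective unique , Linked.map⁺ (Linked.map adjacent linked)

  linear-pullback : ∀ {k} {c : V H → Fin k} → IsLinear H c → IsLinear G (c ∘ embed)
  linear-pullback lin ps path with lin (map embed ps) (embed-path path)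
  ... | _ , v′∈ , unique with ∈-map⁻ embed v′∈
  ...   | v , v∈ps , refl =
    v , v∈ps , λ w w∈ps cw≡cv → injective (unique (embed w) (∈-map⁺ embed w∈ps) cw≡cv)

-- Rook complements and forbidden configurations

rook-centered⇒linear : ∀ {n m k} {c : Fin n × Fin m → Fin k} →
                       IsCentered (RookComplement n m) c → IsLinear (RookComplement n m) c
rook-centered⇒linear = centered⇒linear (λ (i≢i′ , j≢j′) → i≢i′ ∘ sym , j≢j′ ∘ sym) (≡-dec _≟_ _≟_)

transpose : ∀ {n m} → RookComplement m n ↪ RookComplement n m
transpose = record
  { embed     = swap
  ; injective = λ e → cong₂ _,_ (,-injectiveʳ e) (,-injectiveˡ e)
  ; adjacent  = swap
  }

relabel : ∀ {n m} (rows : List (Fin n)) (cols : List (Fin m)) → Unique rows → Unique cols →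
          RookComplement (length rows) (length cols) ↪ RookComplement n m
relabel rows cols unique-rows unique-cols = record
  { embed     = λ (i , j) → lookup rows i , lookup cols j
  ; injective = λ e → cong₂ _,_ (lookup-injective unique-rows (,-injectiveˡ e))
                                (lookup-injective unique-cols (,-injectiveʳ e))
  ; adjacent  = λ (i≢i′ , j≢j′) → i≢i′ ∘ lookup-injective unique-rows ,
                                  j≢j′ ∘ lookup-injective unique-cols
  }

module SmallGrid {a b : ℕ} where

  Cell : Set
  Cell = Fin a × Fin b

  _≟ᶜ_ : DecidableEquality Cell
  _≟ᶜ_ = ≡-dec _≟_ _≟_

  open UniqueDec _≟ᶜ_ using (unique?)
  open MembershipDec _≟ᶜ_ using (_∈?_)

  path? : (ps : List Cell) → Dec (IsPath (RookComplement a b) ps)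
  path? [] = no λ (≢[] , _) → ≢[] refl
  path? ps@(_ ∷ _) = map′ ((λ ()) ,_) proj₂ (unique? ps ×-dec linked? adj? ps)
    where
    adj? : (u v : Cell) → Dec (Adj (RookComplement a b) u v)
    adj? (i , j) (i′ , j′) = ¬? (i ≟ i′) ×-dec ¬? (j ≟ j′)

  -- On concrete cells the side conditions are decided, so only the colour equation is supplied.
  twin : ∀ {k} {c : Cell → Fin k} {ps v} w {_ : True (w ∈? ps)} {_ : False (w ≟ᶜ v)} →
         c w ≡ c v → Twin c ps v
  twin w {w∈ps} {w≢v} cw≡cv = w , toWitness w∈ps , toWitnessFalse w≢v , cw≡cv

  no-twinned-rook-path : ∀ {k} {c : Cell → Fin k} → IsLinear (RookComplement a b) c →
                         (ps : List Cell) {_ : True (path? ps)} → ¬ All (Twin c ps) ps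
  no-twinned-rook-path lin ps {path} = linear⇒no-twinned-path lin (toWitness path)

module Forbidden {k : ℕ} where
  open SmallGrid using (twin; no-twinned-rook-path)

  twins-sharing-a-row : {c : Fin 3 × Fin 2 → Fin k} → IsLinear (RookComplement 3 2) c →
    c (# 0 , # 0) ≡ c (# 1 , # 0) → c (# 1 , # 1) ≡ c (# 2 , # 1) → ⊥
  twins-sharing-a-row lin e₀ e₁ = no-twinned-rook-path lin
    ((# 1 , # 1) ∷ (# 0 , # 0) ∷ (# 2 , # 1) ∷ (# 1 , # 0) ∷ [])
    (twin (# 2 , # 1) (sym e₁) ∷ twin (# 1 , # 0) (sym e₀) ∷ twin (# 1 , # 1) e₁ ∷ twin (# 0 , # 0) e₀ ∷ [])

  twins-in-disjoint-rows : {c : Fin 4 × Fin 2 → Fin k} → IsLinear (RookComplement 4 2) c →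
    c (# 0 , # 0) ≡ c (# 1 , # 0) → c (# 2 , # 1) ≡ c (# 3 , # 1) → ⊥
  twins-in-disjoint-rows lin e₀ e₁ = no-twinned-rook-path lin
    ((# 1 , # 0) ∷ (# 2 , # 1) ∷ (# 0 , # 0) ∷ (# 3 , # 1) ∷ [])
    (twin (# 0 , # 0) e₀ ∷ twin (# 3 , # 1) (sym e₁) ∷ twin (# 1 , # 0) (sym e₀) ∷ twin (# 2 , # 1) e₁ ∷ [])

  crossing-twins : {c : Fin 3 × Fin 3 → Fin k} → IsLinear (RookComplement 3 3) c →
    c (# 0 , # 0) ≡ c (# 1 , # 0) → c (# 2 , # 1) ≡ c (# 2 , # 2) → ⊥
  crossing-twins lin e₀ e₁ = no-twinned-rook-path lin
    ((# 0 , # 0) ∷ (# 2 , # 1) ∷ (# 1 , # 0) ∷ (# 2 , # 2) ∷ [])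
    (twin (# 1 , # 0) (sym e₀) ∷ twin (# 2 , # 2) (sym e₁) ∷ twin (# 0 , # 0) e₀ ∷ twin (# 2 , # 1) e₁ ∷ [])

  hexagon : List (Fin 3 × Fin 2)
  hexagon = (# 0 , # 0) ∷ (# 1 , # 1) ∷ (# 2 , # 0) ∷ (# 0 , # 1) ∷ (# 1 , # 0) ∷ (# 2 , # 1) ∷ []

  hexagon-of-row-twins : {c : Fin 3 × Fin 2 → Fin k} → IsLinear (RookComplement 3 2) c →
    c (# 0 , # 0) ≡ c (# 0 , # 1) → c (# 1 , # 0) ≡ c (# 1 , # 1) → c (# 2 , # 0) ≡ c (# 2 , # 1) → ⊥
  hexagon-of-row-twins lin e₀ e₁ e₂ = no-twinned-rook-path lin hexagon
    (twin (# 0 , # 1) (sym e₀) ∷ twin (# 1 , # 0) e₁ ∷ twin (# 2 , # 1) (sym e₂) ∷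
     twin (# 0 , # 0) e₀ ∷ twin (# 1 , # 1) (sym e₁) ∷ twin (# 2 , # 0) e₂ ∷ [])

  hexagon-of-mixed-twins : {c : Fin 3 × Fin 2 → Fin k} → IsLinear (RookComplement 3 2) c →
    c (# 0 , # 0) ≡ c (# 1 , # 0) → c (# 0 , # 1) ≡ c (# 1 , # 1) → c (# 2 , # 0) ≡ c (# 2 , # 1) → ⊥
  hexagon-of-mixed-twins lin e₀ e₁ e₂ = no-twinned-rook-path lin hexagon
    (twin (# 1 , # 0) (sym e₀) ∷ twin (# 0 , # 1) e₁ ∷ twin (# 2 , # 1) (sym e₂) ∷
     twin (# 1 , # 1) (sym e₁) ∷ twin (# 0 , # 0) e₀ ∷ twin (# 2 , # 0) e₂ ∷ [])

  octagon : {c : Fin 2 × Fin 4 → Fin k} → IsLinear (RookComplement 2 4) c →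
    c (# 0 , # 0) ≡ c (# 1 , # 0) → c (# 0 , # 1) ≡ c (# 1 , # 1) →
    c (# 0 , # 2) ≡ c (# 0 , # 3) → c (# 1 , # 2) ≡ c (# 1 , # 3) → ⊥
  octagon lin e₀ e₁ e₂ e₃ = no-twinned-rook-path lin
    ((# 0 , # 0) ∷ (# 1 , # 1) ∷ (# 0 , # 2) ∷ (# 1 , # 3) ∷
     (# 0 , # 1) ∷ (# 1 , # 0) ∷ (# 0 , # 3) ∷ (# 1 , # 2) ∷ [])
    (twin (# 1 , # 0) (sym e₀) ∷ twin (# 0 , # 1) e₁ ∷ twin (# 0 , # 3) (sym e₂) ∷ twin (# 1 , # 2) e₃ ∷
     twin (# 1 , # 1) (sym e₁) ∷ twin (# 0 , # 0) e₀ ∷ twin (# 0 , # 2) e₂ ∷ twin (# 1 , # 3) (sym e₃) ∷ [])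

-- Twins in a linear colouring

module TwinLemmas {n m k : ℕ} (c : Fin n × Fin m → Fin k) (lin : IsLinear (RookComplement n m) c) where

  ColumnTwins : Fin n → Fin n → Fin m → Set
  ColumnTwins p q j = p ≢ q × c (p , j) ≡ c (q , j)

  RowTwins : Fin n → Fin m → Fin m → Set
  RowTwins i s t = s ≢ t × c (i , s) ≡ c (i , t)

  private
    variable
      a b i p q r r′ : Fin n
      j j′ s t : Fin m

    on-grid : (rows : List (Fin n)) (cols : List (Fin m)) (unique-rows : Unique rows) (unique-cols : Unique cols) →
              IsLinear (RookComplement (length rows) (length cols))
                       (c ∘ _↪_.embed (relabel rows cols unique-rows unique-cols))
    on-grid rows cols unique-rows unique-cols = linear-pullback (relabel rows cols unique-rows unique-cols) lin

  column-twins-sym : ColumnTwins p q j → ColumnTwins q p j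
  column-twins-sym (p≢q , e) = p≢q ∘ sym , sym e

  row-twins-sym : RowTwins i s t → RowTwins i t s
  row-twins-sym (s≢t , e) = s≢t ∘ sym , sym e

  adjacent-colours-differ : a ≢ b → j ≢ j′ → c (a , j) ≢ c (b , j′)
  adjacent-colours-differ a≢b j≢j′ = linear⇒proper lin (a≢b ∘ ,-injectiveˡ) (a≢b , j≢j′)

  column-twins-meet : ColumnTwins p q j → ColumnTwins r r′ j′ → j ≢ j′ → p ≡ r ⊎ p ≡ r′
  column-twins-meet {p} {q} {j} {r} {r′} {j′} (p≢q , e) (r≢r′ , e′) j≢j′ with p ≟ r | p ≟ r′
  ... | yes p≡r | _ = inj₁ p≡r
  ... | no _ | yes p≡r′ = inj₂ p≡r′
  ... | no p≢r | no p≢r′ with q ≟ r | q ≟ r′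
  ...   | yes refl | _ = ⊥-elim (Forbidden.twins-sharing-a-row
          (on-grid (p ∷ q ∷ r′ ∷ []) (j ∷ j′ ∷ []) (distinct₃ p≢q p≢r′ r≢r′) (distinct₂ j≢j′))
          e e′)
  ...   | no _ | yes refl = ⊥-elim (Forbidden.twins-sharing-a-row
          (on-grid (p ∷ q ∷ r ∷ []) (j ∷ j′ ∷ []) (distinct₃ p≢q p≢r (r≢r′ ∘ sym)) (distinct₂ j≢j′))
          e (sym e′))
  ...   | no q≢r | no q≢r′ = ⊥-elim (Forbidden.twins-in-disjoint-rows
          (on-grid (p ∷ q ∷ r ∷ r′ ∷ []) (j ∷ j′ ∷ []) (distinct₄ p≢q p≢r p≢r′ q≢r q≢r′ r≢r′) (distinct₂ j≢j′))
          e e′)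

  column-twins-align : ColumnTwins p q j → ColumnTwins r r′ j′ → j ≢ j′ → ColumnTwins p q j′
  column-twins-align t t′ j≢j′
    with column-twins-meet t t′ j≢j′ | column-twins-meet (column-twins-sym t) t′ j≢j′
  ... | inj₁ refl | inj₂ refl = t′
  ... | inj₂ refl | inj₁ refl = column-twins-sym t′
  ... | inj₁ refl | inj₁ refl = ⊥-elim (proj₁ t refl)
  ... | inj₂ refl | inj₂ refl = ⊥-elim (proj₁ t refl)

  twins-cross : ColumnTwins p q j → RowTwins i s t → j ≢ s → j ≢ t → i ≡ p ⊎ i ≡ q
  twins-cross {p} {q} {j} {i} {s} {t} (p≢q , e) (s≢t , e′) j≢s j≢t with i ≟ p | i ≟ q
  ... | yes i≡p | _ = inj₁ i≡p
  ... | no _ | yes i≡q = inj₂ i≡q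
  ... | no i≢p | no i≢q = ⊥-elim (Forbidden.crossing-twins
          (on-grid (p ∷ q ∷ i ∷ []) (j ∷ s ∷ t ∷ [])
                   (distinct₃ p≢q (i≢p ∘ sym) (i≢q ∘ sym)) (distinct₃ j≢s j≢t s≢t))
          e e′)

  no-row-twins-in-three-rows : RowTwins a s t → RowTwins b s t → RowTwins i s t → a ≢ b → a ≢ i → b ≢ i → ⊥
  no-row-twins-in-three-rows {a} {s} {t} {b} {i} (s≢t , e₀) (_ , e₁) (_ , e₂) a≢b a≢i b≢i =
    Forbidden.hexagon-of-row-twins
      (on-grid (a ∷ b ∷ i ∷ []) (s ∷ t ∷ []) (distinct₃ a≢b a≢i b≢i) (distinct₂ s≢t)) e₀ e₁ e₂

  no-row-twins-bridging-column-twins : ColumnTwins a b j → ColumnTwins a b j′ → RowTwins i j j′ →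
                                       i ≢ a → i ≢ b → ⊥
  no-row-twins-bridging-column-twins {a} {b} {j} {j′} {i} (a≢b , e₀) (_ , e₁) (j≢j′ , e₂) i≢a i≢b =
    Forbidden.hexagon-of-mixed-twins
      (on-grid (a ∷ b ∷ i ∷ []) (j ∷ j′ ∷ []) (distinct₃ a≢b (i≢a ∘ sym) (i≢b ∘ sym)) (distinct₂ j≢j′))
      e₀ e₁ e₂

  row-twins-avoid-column-twins : ColumnTwins a b j → RowTwins a s t → j ≢ s
  row-twins-avoid-column-twins (a≢b , e) (s≢t , e′) refl =
    adjacent-colours-differ (a≢b ∘ sym) s≢t (trans (sym e) e′)

  no-twin-octagon : ColumnTwins a b j → ColumnTwins a b j′ → j ≢ j′ → RowTwins a s t → RowTwins b s t → ⊥
  no-twin-octagon {a} {b} {j} {j′} {s} {t} t₀@(a≢b , e₀) t₁@(_ , e₁) j≢j′ h@(s≢t , e₂) (_ , e₃) =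
    Forbidden.octagon
      (on-grid (a ∷ b ∷ []) (j ∷ j′ ∷ s ∷ t ∷ []) (distinct₂ a≢b)
        (distinct₄ j≢j′ (row-twins-avoid-column-twins t₀ h) (row-twins-avoid-column-twins t₀ (row-twins-sym h))
                        (row-twins-avoid-column-twins t₁ h) (row-twins-avoid-column-twins t₁ (row-twins-sym h)) s≢t))
      e₀ e₁ e₂ e₃

module Twins {n m k : ℕ} (c : Fin n × Fin m → Fin k) (lin : IsLinear (RookComplement n m) c) where
  open TwinLemmas c lin public

  private
    module T = TwinLemmas (c ∘ swap) (linear-pullback transpose lin)
    variable
      a b i i′ p q : Fin n
      j s t s′ t′ x y : Fin m

  row-twins-meet : RowTwins i s t → RowTwins i′ s′ t′ → i ≢ i′ → s ≡ s′ ⊎ s ≡ t′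
  row-twins-meet = T.column-twins-meet

  row-twins-align : RowTwins i s t → RowTwins i′ s′ t′ → i ≢ i′ → RowTwins i′ s t
  row-twins-align = T.column-twins-align

  twins-crossᵀ : RowTwins i s t → ColumnTwins p q j → i ≢ p → i ≢ q → j ≡ s ⊎ j ≡ t
  twins-crossᵀ = T.twins-cross

  no-column-twins-in-three-columns : ColumnTwins a b j → ColumnTwins a b s → ColumnTwins a b t →
                                     j ≢ s → j ≢ t → s ≢ t → ⊥
  no-column-twins-in-three-columns = T.no-row-twins-in-three-rows

  no-column-twins-bridging-row-twins : RowTwins a x y → RowTwins b x y → ColumnTwins a b j → j ≢ x → j ≢ y → ⊥
  no-column-twins-bridging-row-twins = T.no-row-twins-bridging-column-twins

-- Small covers of the twins

module Classification {n₁ m₁ k : ℕ} (c : Fin (suc n₁) × Fin (suc m₁) → Fin k)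
                      (lin : IsLinear (RookComplement (suc n₁) (suc m₁)) c) where
  open Twins c lin

  n m : ℕ
  n = suc n₁
  m = suc m₁

  Cell : Set
  Cell = Fin n × Fin m

  ColumnBut : Fin m → Fin n → Cell → Set
  ColumnBut j x (i , j′) = j′ ≡ j × i ≢ x

  RowBut : Fin n → Fin m → Cell → Set
  RowBut i w (i′ , j) = i′ ≡ i × j ≢ w

  Row : Fin n → Cell → Set
  Row i (i′ , _) = i′ ≡ i

  record Cover (R : Cell → Set) : Set where
    field
      row-twins    : ∀ {i s t} → RowTwins i s t → R (i , s) ⊎ R (i , t)
      column-twins : ∀ {p q j} → ColumnTwins p q j → R (p , j) ⊎ R (q , j)

  -- Off these sets lie n(m - 1) + 1, (n - 1)m + 1 and (n - 1)m cells; the last is enough only if m < n.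
  data SmallCover : Set where
    column-but : ∀ j x → Cover (ColumnBut j x) → SmallCover
    row-but    : ∀ i w → Cover (RowBut i w) → SmallCover
    row        : m < n → ∀ i → Cover (Row i) → SmallCover

  private
    variable
      a b i i₀ i₁ i₂ p q x : Fin n
      j j₀ j₁ s t w y z : Fin m

  column-but-covers : ∀ j x → p ≢ q → ColumnBut j x (p , j) ⊎ ColumnBut j x (q , j)
  column-but-covers {p} j x p≢q with p ≟ x
  ... | no p≢x = inj₁ (refl , p≢x)
  ... | yes refl = inj₂ (refl , p≢q ∘ sym)

  row-but-covers : ∀ i w → s ≢ t → RowBut i w (i , s) ⊎ RowBut i w (i , t)
  row-but-covers {s} i w s≢t with s ≟ w
  ... | no s≢w = inj₁ (refl , s≢w)
  ... | yes refl = inj₂ (refl , s≢t ∘ sym)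

  module _ (3≤n : 3 ≤ n) (m≤n : m ≤ n) (no-cover : ¬ SmallCover) where

    row-twins-in-one-row : (∀ {p q j} → ¬ ColumnTwins p q j) →
                           ∀ i₀ w → (∀ {i s t} → RowTwins i s t → i ≡ i₀) → ⊥
    row-twins-in-one-row no-column-twins i₀ w in-row-i₀ = no-cover (row-but i₀ w record
      { row-twins    = covered
      ; column-twins = ⊥-elim ∘ no-column-twins
      })
      where
      covered : RowTwins i s t → RowBut i₀ w (i , s) ⊎ RowBut i₀ w (i , t)
      covered h with in-row-i₀ h
      ... | refl = row-but-covers i₀ w (proj₁ h)

    row-twins-in-two-rows : (∀ {p q j} → ¬ ColumnTwins p q j) →
                            RowTwins i₁ y z → RowTwins i₂ s t → i₁ ≢ i₂ → ⊥
    row-twins-in-two-rows {i₁} {y} {z} {i₂} no-column-twins h₁ h₂ i₁≢i₂ with third-element 3≤n i₁ i₂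
    ... | x , x≢i₁ , x≢i₂ = no-cover (column-but y x record
      { row-twins    = λ h → Sum.map (λ y≡s → sym y≡s , off-row-x h) (λ y≡t → sym y≡t , off-row-x h)
                                     (through-y h)
      ; column-twins = ⊥-elim ∘ no-column-twins
      })
      where
      h₂′ : RowTwins i₂ y z
      h₂′ = row-twins-align h₁ h₂ i₁≢i₂
      through-y : RowTwins i s t → y ≡ s ⊎ y ≡ t
      through-y {i} h with i ≟ i₁
      ... | yes refl = row-twins-meet h₂′ h (i₁≢i₂ ∘ sym)
      ... | no i≢i₁ = row-twins-meet h₁ h (i≢i₁ ∘ sym)
      off-row-x : RowTwins i s t → i ≢ x
      off-row-x h refl = no-row-twins-in-three-rows h₁ h₂′ (row-twins-align h₁ h (x≢i₁ ∘ sym))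
                           i₁≢i₂ (x≢i₁ ∘ sym) (x≢i₂ ∘ sym)

    without-column-twins : (∀ {p q j} → ¬ ColumnTwins p q j) → ⊥
    without-column-twins no-column-twins = by-cases (∃[ i₁ ] ∃[ y ] ∃[ z ] RowTwins i₁ y z)
      (λ (i₁ , y , _ , h₁) → by-cases (∃[ i₂ ] ∃[ s ] ∃[ t ] i₁ ≢ i₂ × RowTwins i₂ s t)
        (λ (_ , _ , _ , i₁≢i₂ , h₂) → row-twins-in-two-rows no-column-twins h₁ h₂ i₁≢i₂)
        (λ none → row-twins-in-one-row no-column-twins i₁ y (in-row none)))
      (λ none → row-twins-in-one-row no-column-twins zero zero (λ h → ⊥-elim (none (_ , _ , _ , h))))
      where
      in-row : ¬ (∃[ i₂ ] ∃[ s ] ∃[ t ] i₁ ≢ i₂ × RowTwins i₂ s t) → RowTwins i s t → i ≡ i₁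
      in-row {i₁} {i} none h with i ≟ i₁
      ... | yes i≡i₁ = i≡i₁
      ... | no i≢i₁ = ⊥-elim (none (_ , _ , _ , i≢i₁ ∘ sym , h))

    module TwoColumns (t₀ : ColumnTwins a b j₀) (t₁ : ColumnTwins a b j₁) (j₀≢j₁ : j₀ ≢ j₁) where

      column-twins-through-a : ColumnTwins p q j → (a ≡ p ⊎ a ≡ q) × (j ≡ j₀ ⊎ j ≡ j₁)
      column-twins-through-a {j = j} t with j ≟ j₀ | j ≟ j₁
      ... | yes refl | _ = column-twins-meet t₁ t (j₀≢j₁ ∘ sym) , inj₁ refl
      ... | no _ | yes refl = column-twins-meet t₀ t j₀≢j₁ , inj₂ refl
      ... | no j≢j₀ | no j≢j₁ = ⊥-elim (no-column-twins-in-three-columns t₀ t₁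
                                   (column-twins-align t₀ t (j≢j₀ ∘ sym)) j₀≢j₁ (j≢j₀ ∘ sym) (j≢j₁ ∘ sym))

      column-twins-covered : (R : Cell → Set) → R (a , j₀) → R (a , j₁) →
                             ColumnTwins p q j → R (p , j) ⊎ R (q , j)
      column-twins-covered R R₀ R₁ t with column-twins-through-a t
      ... | inj₁ refl , inj₁ refl = inj₁ R₀
      ... | inj₁ refl , inj₂ refl = inj₁ R₁
      ... | inj₂ refl , inj₁ refl = inj₂ R₀
      ... | inj₂ refl , inj₂ refl = inj₂ R₁

      row-twins-in-rows-ab : RowTwins i s t → i ≡ a ⊎ i ≡ b
      row-twins-in-rows-ab {i} h with i ≟ a | i ≟ b
      ... | yes i≡a | _ = inj₁ i≡a
      ... | no _ | yes i≡b = inj₂ i≡b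
      ... | no i≢a | no i≢b with twins-crossᵀ h t₀ i≢a i≢b | twins-crossᵀ h t₁ i≢a i≢b
      ...   | inj₁ refl | inj₂ refl = ⊥-elim (no-row-twins-bridging-column-twins t₀ t₁ h i≢a i≢b)
      ...   | inj₂ refl | inj₁ refl = ⊥-elim (no-row-twins-bridging-column-twins t₀ t₁ (row-twins-sym h) i≢a i≢b)
      ...   | inj₁ refl | inj₁ refl = ⊥-elim (j₀≢j₁ refl)
      ...   | inj₂ refl | inj₂ refl = ⊥-elim (j₀≢j₁ refl)

      no-row-twins-in-both-rows : RowTwins a s t → RowTwins b y z → ⊥
      no-row-twins-in-both-rows hₐ h_b = no-twin-octagon t₀ t₁ j₀≢j₁ hₐ (row-twins-align hₐ h_b (proj₁ t₀))

      row-twins-covered : (∀ {s t} → ¬ RowTwins b s t) → (R : Cell → Set) →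
                          (∀ {s t} → s ≢ t → R (a , s) ⊎ R (a , t)) → RowTwins i s t → R (i , s) ⊎ R (i , t)
      row-twins-covered no-row-twins-in-b R covers-row-a h with row-twins-in-rows-ab h
      ... | inj₁ refl = covers-row-a (proj₁ h)
      ... | inj₂ refl = ⊥-elim (no-row-twins-in-b h)

      row-a-covers : (∀ {s t} → ¬ RowTwins b s t) → ⊥
      row-a-covers no-row-twins-in-b with m <? n
      ... | yes m<n = no-cover (row m<n a record
        { row-twins    = row-twins-covered no-row-twins-in-b (Row a) (λ _ → inj₁ refl)
        ; column-twins = column-twins-covered (Row a) refl refl
        })
      ... | no m≮n with third-element (≤-trans 3≤n (≮⇒≥ m≮n)) j₀ j₁
      ...   | w , w≢j₀ , w≢j₁ = no-cover (row-but a w record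
        { row-twins    = row-twins-covered no-row-twins-in-b (RowBut a w) (row-but-covers a w)
        ; column-twins = column-twins-covered (RowBut a w) (refl , w≢j₀ ∘ sym) (refl , w≢j₁ ∘ sym)
        })

    two-columns : ColumnTwins a b j₀ → ColumnTwins a b j₁ → j₀ ≢ j₁ → ⊥
    two-columns {a} {b} t₀ t₁ j₀≢j₁ = by-cases (∃[ s ] ∃[ t ] RowTwins b s t)
      (λ (_ , _ , h_b) → TwoColumns.row-a-covers (column-twins-sym t₀) (column-twins-sym t₁) j₀≢j₁
                           (λ hₐ → TwoColumns.no-row-twins-in-both-rows t₀ t₁ j₀≢j₁ hₐ h_b))
      (λ none → TwoColumns.row-a-covers t₀ t₁ j₀≢j₁ (λ h → none (_ , _ , h)))

    module OneColumn (t₀ : ColumnTwins a b j₀) (in-column-j₀ : ∀ {p q j} → ColumnTwins p q j → j ≡ j₀) where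

      row-twins-in-row-of : RowTwins i₀ y z → j₀ ≢ y → j₀ ≢ z → RowTwins i s t → i ≡ i₀
      row-twins-in-row-of {i₀} {i = i} h₀ j₀≢y j₀≢z h with i ≟ i₀
      ... | yes i≡i₀ = i≡i₀
      ... | no i≢i₀ with row-twins-align h₀ h (i≢i₀ ∘ sym)
      ...   | h′ with twins-cross t₀ h₀ j₀≢y j₀≢z | twins-cross t₀ h′ j₀≢y j₀≢z
      ...     | inj₁ refl | inj₂ refl = ⊥-elim (no-column-twins-bridging-row-twins h₀ h′ t₀ j₀≢y j₀≢z)
      ...     | inj₂ refl | inj₁ refl = ⊥-elim (no-column-twins-bridging-row-twins h′ h₀ t₀ j₀≢y j₀≢z)
      ...     | inj₁ refl | inj₁ refl = ⊥-elim (i≢i₀ refl)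
      ...     | inj₂ refl | inj₂ refl = ⊥-elim (i≢i₀ refl)

      row-twins-off-column : RowTwins i₀ y z → j₀ ≢ y → j₀ ≢ z → ⊥
      row-twins-off-column {i₀} {y} h₀ j₀≢y j₀≢z = no-cover (row-but i₀ y record
        { row-twins    = covered
        ; column-twins = column-covered
        })
        where
        covered : RowTwins i s t → RowBut i₀ y (i , s) ⊎ RowBut i₀ y (i , t)
        covered h with row-twins-in-row-of h₀ j₀≢y j₀≢z h
        ... | refl = row-but-covers i₀ y (proj₁ h)
        column-covered : ColumnTwins p q j → RowBut i₀ y (p , j) ⊎ RowBut i₀ y (q , j)
        column-covered t with in-column-j₀ t
        ... | refl = Sum.map (λ i₀≡p → sym i₀≡p , j₀≢y) (λ i₀≡q → sym i₀≡q , j₀≢y)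
                             (twins-cross t h₀ j₀≢y j₀≢z)

      column-but-lonely-cell-covers : (∀ {i s t} → RowTwins i s t → s ≡ j₀ ⊎ t ≡ j₀) →
                                      (∀ {y} → ¬ RowTwins x j₀ y) → ⊥
      column-but-lonely-cell-covers {x} touch-j₀ lonely = no-cover (column-but j₀ x record
        { row-twins    = covered
        ; column-twins = column-covered
        })
        where
        covered : RowTwins i s t → ColumnBut j₀ x (i , s) ⊎ ColumnBut j₀ x (i , t)
        covered h with touch-j₀ h
        ... | inj₁ refl = inj₁ (refl , λ { refl → lonely h })
        ... | inj₂ refl = inj₂ (refl , λ { refl → lonely (row-twins-sym h) })
        column-covered : ColumnTwins p q j → ColumnBut j₀ x (p , j) ⊎ ColumnBut j₀ x (q , j)
        column-covered t with in-column-j₀ t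
        ... | refl = column-but-covers j₀ x (proj₁ t)

      no-row-twins-at-both-ends : RowTwins a j₀ y → RowTwins b j₀ z → ⊥
      no-row-twins-at-both-ends {y} {z} (j₀≢y , e) (_ , e′) with y ≟ z | trans (sym e) (trans (proj₂ t₀) e′)
      ... | no y≢z | same-colour = adjacent-colours-differ (proj₁ t₀) y≢z same-colour
      ... | yes refl | same-colour = j₀≢y (sym (in-column-j₀ (proj₁ t₀ , same-colour)))

      one-column : ⊥
      one-column = by-cases (∃[ i₀ ] ∃[ y ] ∃[ z ] j₀ ≢ y × j₀ ≢ z × RowTwins i₀ y z)
        (λ (_ , _ , _ , j₀≢y , j₀≢z , h₀) → row-twins-off-column h₀ j₀≢y j₀≢z)
        (λ none → by-cases (∃[ y ] RowTwins a j₀ y)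
          (λ (_ , hₐ) → column-but-lonely-cell-covers (touch-j₀ none) (no-row-twins-at-both-ends hₐ))
          (λ lonely-a → column-but-lonely-cell-covers (touch-j₀ none) (λ hₐ → lonely-a (_ , hₐ))))
        where
        touch-j₀ : ¬ (∃[ i₀ ] ∃[ y ] ∃[ z ] j₀ ≢ y × j₀ ≢ z × RowTwins i₀ y z) →
                   RowTwins i s t → s ≡ j₀ ⊎ t ≡ j₀
        touch-j₀ {s = s} {t} none h with s ≟ j₀ | t ≟ j₀
        ... | yes s≡j₀ | _ = inj₁ s≡j₀
        ... | no _ | yes t≡j₀ = inj₂ t≡j₀
        ... | no s≢j₀ | no t≢j₀ = ⊥-elim (none (_ , _ , _ , s≢j₀ ∘ sym , t≢j₀ ∘ sym , h))

    case-analysis : ⊥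
    case-analysis = by-cases (∃[ a ] ∃[ b ] ∃[ j₀ ] ColumnTwins a b j₀)
      (λ (_ , _ , j₀ , t₀) → by-cases (∃[ p ] ∃[ q ] ∃[ j₁ ] j₀ ≢ j₁ × ColumnTwins p q j₁)
        (λ (_ , _ , _ , j₀≢j₁ , t₁) → two-columns t₀ (column-twins-align t₀ t₁ j₀≢j₁) j₀≢j₁)
        (λ none → OneColumn.one-column t₀ (in-column none)))
      (λ none → without-column-twins (λ t → none (_ , _ , _ , t)))
      where
      in-column : ¬ (∃[ p ] ∃[ q ] ∃[ j₁ ] j₀ ≢ j₁ × ColumnTwins p q j₁) → ColumnTwins p q j → j ≡ j₀
      in-column {j₀} {j = j} none t with j ≟ j₀
      ... | yes j≡j₀ = j≡j₀
      ... | no j≢j₀ = ⊥-elim (none (_ , _ , _ , j≢j₀ ∘ sym , t))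

  small-cover : 3 ≤ n → m ≤ n → ¬ ¬ SmallCover
  small-cover = case-analysis

-- The lower bound

module LowerBound {n₁ m₁ k : ℕ} (c : Fin (suc n₁) × Fin (suc m₁) → Fin k)
                  (lin : IsLinear (RookComplement (suc n₁) (suc m₁)) c) where
  open Twins c lin
  open Classification c lin

  private
    variable
      R : Cell → Set
      M : ℕ
      i x : Fin n
      j w : Fin m

  cover⇒injective : Cover R → ∀ {u v} → ¬ R u → ¬ R v → c u ≡ c v → u ≡ v
  cover⇒injective cover {i , s} {i′ , t} ¬Ru ¬Rv e with i ≟ i′ | s ≟ t
  ... | yes refl | yes refl = refl
  ... | yes refl | no s≢t = ⊥-elim ([ ¬Ru , ¬Rv ] (Cover.row-twins cover (s≢t , e)))
  ... | no i≢i′ | yes refl = ⊥-elim ([ ¬Ru , ¬Rv ] (Cover.column-twins cover (i≢i′ , e)))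
  ... | no i≢i′ | no s≢t = ⊥-elim (adjacent-colours-differ i≢i′ s≢t e)

  cover-bound : Cover R → (g : Fin M → Cell) → Injective _≡_ _≡_ g → (∀ t → ¬ R (g t)) → M ≤ k
  cover-bound cover g g-injective off-R =
    injective⇒≤ (g-injective ∘ cover⇒injective cover (off-R _) (off-R _))

  off-column : Fin m → Fin (n * m₁) → Cell
  off-column j = (λ (i , j′) → i , punchIn j j′) ∘ remQuot m₁

  off-column-injective : Injective _≡_ _≡_ (off-column j)
  off-column-injective {j} e =
    remQuot-injective m₁ (cong₂ _,_ (,-injectiveˡ e) (punchIn-injective j _ _ (,-injectiveʳ e)))

  off-row : Fin n → Fin (n₁ * m) → Cell
  off-row i = (λ (i′ , j) → punchIn i i′ , j) ∘ remQuot m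

  off-row-injective : Injective _≡_ _≡_ (off-row i)
  off-row-injective {i} e =
    remQuot-injective m (cong₂ _,_ (punchIn-injective i _ _ (,-injectiveˡ e)) (,-injectiveʳ e))

  column-but-bound : Cover (ColumnBut j x) → suc (n * m₁) ≤ k
  column-but-bound {j} {x} cover = cover-bound cover ((x , j) Vector.∷ off-column j)
    (cons-injective off-column-injective (λ _ → punchInᵢ≢i j _ ∘ ,-injectiveʳ))
    λ { zero (_ , x≢x) → x≢x refl ; (suc _) (in-column-j , _) → punchInᵢ≢i j _ in-column-j }

  row-but-bound : Cover (RowBut i w) → suc (n₁ * m) ≤ k
  row-but-bound {i} {w} cover = cover-bound cover ((i , w) Vector.∷ off-row i)
    (cons-injective off-row-injective (λ _ → punchInᵢ≢i i _ ∘ ,-injectiveˡ))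
    λ { zero (_ , w≢w) → w≢w refl ; (suc _) (in-row-i , _) → punchInᵢ≢i i _ in-row-i }

  row-bound : Cover (Row i) → n₁ * m ≤ k
  row-bound {i} cover = cover-bound cover (off-row i) off-row-injective (λ _ → punchInᵢ≢i i _)

  grid-inequality : ∀ d → d + m₁ ≤ n₁ → d + n * m₁ ≤ n₁ * m
  grid-inequality d d+m₁≤n₁ = begin
    d + (m₁ + n₁ * m₁)  ≡⟨ +-assoc d m₁ (n₁ * m₁) ⟨
    d + m₁ + n₁ * m₁    ≤⟨ +-monoˡ-≤ (n₁ * m₁) d+m₁≤n₁ ⟩
    n₁ + n₁ * m₁        ≡⟨ *-suc n₁ m₁ ⟨
    n₁ * m              ∎
    where open ≤-Reasoning

  small-cover-bound : m ≤ n → SmallCover → suc (n * m₁) ≤ k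
  small-cover-bound _ (column-but _ _ cover) = column-but-bound cover
  small-cover-bound m≤n (row-but _ _ cover) =
    ≤-trans (s≤s (grid-inequality 0 (s≤s⁻¹ m≤n))) (row-but-bound cover)
  small-cover-bound _ (row m<n _ cover) = ≤-trans (grid-inequality 1 (s≤s⁻¹ m<n)) (row-bound cover)

  lower-bound : 3 ≤ n → m ≤ n → suc (n * m₁) ≤ k
  lower-bound 3≤n m≤n =
    decidable-stable (suc (n * m₁) ≤? k) (¬¬-map (small-cover-bound m≤n) (small-cover 3≤n m≤n))

-- Colourings attaining the bounds

column-colouring : ∀ {n m₁} → Fin n × Fin (suc m₁) → Fin (suc (n * m₁))
column-colouring (_ , zero) = zero
column-colouring (i , suc j) = suc (combine i j)

column-colouring-centered : ∀ {n m₁} → IsCentered (RookComplement n (suc m₁)) column-colouring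
column-colouring-centered S connected with any? (λ i → any? (λ j → S (i , suc j) ≟ᵇ true))
... | yes (i , j , in-S) = (i , suc j) , in-S , unique
  where
  unique : ∀ w → S w ≡ true → column-colouring w ≡ column-colouring (i , suc j) → w ≡ (i , suc j)
  unique (i′ , suc j′) _ e with combine-injective i′ j′ i j (suc-injective e)
  ... | refl , refl = refl
... | no none-outside = independent⇒unique-colour column-colouring connected
        λ Su Sv (_ , j≢j′) → j≢j′ (trans (in-column-zero Su) (sym (in-column-zero Sv)))
  where
  in-column-zero : ∀ {i j} → S (i , j) ≡ true → j ≡ zero
  in-column-zero {j = zero} _ = refl
  in-column-zero {i} {suc j} in-S = ⊥-elim (none-outside (i , j , in-S))

one-column-has-no-edges : ∀ {n u v} → ¬ Adj (RookComplement n 1) u v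
one-column-has-no-edges {u = _ , zero} {_ , zero} (_ , 0≢0) = 0≢0 refl

χ-one-column : ∀ {n} → 1 ≤ n → Chromatic (RookComplement n 1) 1
χ-one-column {suc _} _ = chromatic rook-centered⇒linear (λ _ → zero)
  (λ S connected → independent⇒unique-colour _ connected λ _ _ → one-column-has-no-edges)
  (λ _ c _ → ≤-trans (s≤s z≤n) (toℕ<n (c (zero , zero))))

on-diagonal : Fin 2 × Fin 2 → Bool
on-diagonal (i , j) = does (i ≟ j)

adjacent-on-diagonal : ∀ {u v} → Adj (RookComplement 2 2) u v → on-diagonal u ≡ on-diagonal v
adjacent-on-diagonal {zero , zero} {suc zero , suc zero} _ = refl
adjacent-on-diagonal {zero , suc zero} {suc zero , zero} _ = refl
adjacent-on-diagonal {suc zero , zero} {zero , suc zero} _ = refl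
adjacent-on-diagonal {suc zero , suc zero} {zero , zero} _ = refl
adjacent-on-diagonal {zero , _} {zero , _} (0≢0 , _) = ⊥-elim (0≢0 refl)
adjacent-on-diagonal {suc zero , _} {suc zero , _} (1≢1 , _) = ⊥-elim (1≢1 refl)
adjacent-on-diagonal {_ , zero} {_ , zero} (_ , 0≢0) = ⊥-elim (0≢0 refl)
adjacent-on-diagonal {_ , suc zero} {_ , suc zero} (_ , 1≢1) = ⊥-elim (1≢1 refl)

on-diagonal-and-column-determine : ∀ {u v} → on-diagonal u ≡ on-diagonal v → proj₂ u ≡ proj₂ v → u ≡ v
on-diagonal-and-column-determine {zero , _} {zero , _} _ refl = refl
on-diagonal-and-column-determine {suc zero , _} {suc zero , _} _ refl = refl
on-diagonal-and-column-determine {zero , zero} {suc zero , zero} () refl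
on-diagonal-and-column-determine {zero , suc zero} {suc zero , suc zero} () refl
on-diagonal-and-column-determine {suc zero , zero} {zero , zero} () refl
on-diagonal-and-column-determine {suc zero , suc zero} {zero , suc zero} () refl

χ-two-by-two : Chromatic (RookComplement 2 2) 2
χ-two-by-two = chromatic rook-centered⇒linear proj₂ centered
  (λ _ c lin → adjacent⇒2≤colours lin {# 0 , # 0} {# 1 , # 1} (λ ()) ((λ ()) , (λ ())))
  where
  centered : IsCentered (RookComplement 2 2) proj₂
  centered S ((v , v∈S) , connected) = v , v∈S , λ w w∈S same-column →
    on-diagonal-and-column-determine
      (sym (walk-invariant on-diagonal (λ _ _ → adjacent-on-diagonal) (connected v w v∈S w∈S))) same-column

colour-count : ∀ n m₁ → n * suc m₁ ∸ n + 1 ≡ suc (n * m₁)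
colour-count n m₁ = begin
  n * suc m₁ ∸ n + 1  ≡⟨ cong (λ x → x ∸ n + 1) (*-suc n m₁) ⟩
  n + n * m₁ ∸ n + 1  ≡⟨ cong (_+ 1) (m+n∸m≡n n (n * m₁)) ⟩
  n * m₁ + 1          ≡⟨ +-comm (n * m₁) 1 ⟩
  suc (n * m₁)        ∎
  where open ≡-Reasoning

χ-large : ∀ {n m} → 3 ≤ n → 1 ≤ m → m ≤ n → Chromatic (RookComplement n m) (n * m ∸ n + 1)
χ-large {suc n₁} {suc m₁} 3≤n _ m≤n = subst (Chromatic _) (sym (colour-count (suc n₁) m₁))
  (chromatic rook-centered⇒linear column-colouring column-colouring-centered
    (λ _ c lin → LowerBound.lower-bound c lin 3≤n m≤n))

χ-small : ∀ {n m} → 1 ≤ m → m ≤ n → ¬ (2 ≤ m × 3 ≤ n) → Chromatic (RookComplement n m) m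
χ-small {m = 1} _ 1≤n _ = χ-one-column 1≤n
χ-small {n = 2} {m = 2} _ _ _ = χ-two-by-two
χ-small {n = suc (suc (suc _))} {m = suc (suc _)} _ _ small =
  ⊥-elim (small (s≤s (s≤s z≤n) , s≤s (s≤s (s≤s z≤n))))
χ-small {n = 2} {m = suc (suc (suc _))} _ (s≤s (s≤s ())) _
χ-small {n = 1} {m = suc (suc _)} _ (s≤s ()) _
χ-small {n = 0} {m = suc (suc _)} _ () _
χ-small {m = 0} () _ _

theorem4p6 : (n m : ℕ) → 1 ≤ m → m ≤ n →
    ((2 ≤ m × 3 ≤ n) →
       ChiCen (RookComplement n m) (n * m ∸ n + 1) × ChiLin (RookComplement n m) (n * m ∸ n + 1)) ×
    (¬ (2 ≤ m × 3 ≤ n) →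
       ChiCen (RookComplement n m) m × ChiLin (RookComplement n m) m)
theorem4p6 n m 1≤m m≤n = (λ (_ , 3≤n) → χ-large 3≤n 1≤m m≤n) , χ-small 1≤m m≤n
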